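{- Let $a\geq 4$ and let $k$ be an integer with $2\leq k\leq a/2$. Let $D$ be a strongly connected balanced bipartite digraph of order $2a$ with partite sets $X$ and $Y$ satisfying condition $B_k$. If $D$ is not Hamiltonian, then every vertex $u\in V(D)$ has a partner in $D$, i.e., for every vertex $u$ there is a vertex $v\neq u$ such that $u$ and $v$ have a common out-neighbour.
   Context: Digraphs are finite, without loops and without multiple arcs. A digraph is bipartite with partite sets $X,Y$ if every arc has one end in $X$ and the other in $Y$; it is balanced if $|X|=|Y|$. For a vertex $x$, $d(x)=d^+(x)+d^-(x)$. A pair of distinct vertices $\{x,y\}$ is dominating if there is a vertex $z$ with $xz, yz\in A(D)$; then $x$ and $y$ are called partners of each other. A balanced bipartite digraph of order $2a$ satisfies condition $B_k$ if for every dominating pair $\{x,y\}$ either ($d(x)\geq 2a-k$ and $d(y)\geq a+k$) or ($d(x)\geq a+k$ and $d(y)\geq 2a-k$). $D$ is Hamiltonian if it contains a directed cycle through all its vertices. -}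

module Defs where

open import Data.Nat using (ℕ; zero; suc; _+_; _≤_; _<_; _≥_)
open import Data.Nat.Properties using (_<?_)
open import Data.Bool using (Bool; true; false; T)
open import Data.Fin using (Fin; toℕ; zero; suc)
open import Data.Fin.Properties using ()
open import Data.List using (List; length; filter)
open import Data.List using (allFin)
open import Data.Product using (Σ; _×_; _,_; ∃)
open import Data.Sum using (_⊎_)
open import Relation.Nullary using (¬_)
open import Relation.Binary.PropositionalEquality using (_≡_; _≢_)
open import Function.Bundles using (Bijection)
open import Relation.Binary.PropositionalEquality using (setoid)

record Digraph (n : ℕ) : Set where
  field
    adj     : Fin n → Fin n → Bool
    loopless : ∀ x → adj x x ≡ false
open Digraph public

Arc : ∀ {n} → Digraph n → Fin n → Fin n → Set
Arc D x y = T (adj D x y)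

outdeg : ∀ {n} → Digraph n → Fin n → ℕ
outdeg {n} D x = length (filter (λ y → Data.Bool._≟_ (adj D x y) true) (allFin n))

indeg : ∀ {n} → Digraph n → Fin n → ℕ
indeg {n} D x = length (filter (λ y → Data.Bool._≟_ (adj D y x) true) (allFin n))

deg : ∀ {n} → Digraph n → Fin n → ℕ
deg D x = outdeg D x + indeg D x

-- Balanced bipartite digraph of order 2a: vertex set Fin (a + a),
-- partite sets X = {v | toℕ v < a}, Y = {v | toℕ v ≥ a}.
InX : (a : ℕ) → Fin (a + a) → Set
InX a v = toℕ v < a

SameSide : (a : ℕ) → Fin (a + a) → Fin (a + a) → Set
SameSide a x y = (InX a x × InX a y) ⊎ (¬ InX a x × ¬ InX a y)

IsBipartite : (a : ℕ) → Digraph (a + a) → Set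
IsBipartite a D = ∀ x y → Arc D x y → ¬ SameSide a x y

Dominating : ∀ {n} → Digraph n → Fin n → Fin n → Set
Dominating D x y = x ≢ y × Σ _ (λ z → Arc D x z × Arc D y z)

ConditionB : (a : ℕ) → ℕ → Digraph (a + a) → Set
ConditionB a k D = ∀ x y → Dominating D x y →
  (deg D x + k ≥ a + a × deg D y ≥ a + k) ⊎ (deg D x ≥ a + k × deg D y + k ≥ a + a)

data Reach {n} (D : Digraph n) : Fin n → Fin n → Set where
  here : ∀ {x} → Reach D x x
  step : ∀ {x y z} → Arc D x y → Reach D y z → Reach D x z

StronglyConnected : ∀ {n} → Digraph n → Set
StronglyConnected D = ∀ x y → Reach D x y

-- successor on Fin n cyclically (n ≥ 1 since Fin n inhabited)
next : ∀ {n} → Fin n → Fin n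
next {suc n} i with suc (toℕ i) Data.Nat.Properties.<? suc n
... | Relation.Nullary.yes p = Data.Fin.fromℕ< p
... | Relation.Nullary.no _  = zero

-- Hamiltonian: there is a cyclic ordering σ(0),…,σ(n-1) of all vertices
-- (σ a bijection) with arcs σ(i) → σ(i+1 mod n).
Hamiltonian : ∀ {n} → Digraph n → Set
Hamiltonian {n} D =
  Σ (Bijection (setoid (Fin n)) (setoid (Fin n)))
    (λ σ → ∀ i → Arc D (Bijection.to σ i) (Bijection.to σ (next i)))

module Submission where

-- Suppose u has no partner.  In a balanced bipartite digraph d⁺(z) ≤ a, since all
--     out-neighbours of z lie in the other part.  If w has no partner and wz
--     is an arc, then w is the only in-neighbour of z, so d(z) ≤ a + 1.
--  2. Propagation.  Condition B_k gives every vertex with a partner degree at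
--     least a + k ≥ a + 2 or at least 2a - k ≥ a + k; so the head of an arc
--     leaving a partnerless vertex is partnerless.  By strong connectivity
--     no vertex has a partner, i.e. every vertex has at most one in-neighbour.
--  3. Cycle.  A strongly connected digraph on n ≥ 2 vertices in which every
--     vertex has at most one in-neighbour is a Hamiltonian cycle: choosing an
--     out-neighbour q(w) of each w gives an injective, hence bijective, map
--     q; every arc is of the form w q(w), so every vertex lies on the orbit
--     of one vertex u under q, and u, q(u), …, q^(n-1)(u) is a Hamiltonian
--     cycle.  This contradicts the hypothesis, and since having a partner is
--     decidable, u has a partner.

open import Defs
open import Data.Nat using (ℕ; zero; suc; _+_; _∸_; _*_; _≤_; _<_; z≤n; s≤s)
open import Data.Nat.Properties
  using (_<?_; ≤-reflexive; ≤-trans; ≤-antisym; ≤-pred; <⇒≤; <⇒≢; ≤⇒≯; ≮⇒≥; n<1+n; m+n≮m;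
         m∸n≤m; m<n⇒0<n∸m; m+[n∸m]≡n; +-identityʳ; +-assoc; +-cancelˡ-≤; +-cancelʳ-≤;
         +-monoˡ-≤; +-mono-≤; m≤m+n; 1+n≰n; module ≤-Reasoning)
open import Data.Bool using (true)
open import Data.Bool.Properties using (T-≡)
open import Data.Fin using (Fin; toℕ; fromℕ<; _↑ˡ_; _↑ʳ_; punchOut)
open import Data.Fin.Properties
  using (_≟_; any?; toℕ<n; toℕ-↑ˡ; toℕ-↑ʳ; toℕ-fromℕ<; punchOut-injective; injective⇒≤; pigeonhole)
open import Data.List using (List; []; _∷_; _++_; length; filter; tabulate; allFin)
open import Data.List.Properties using (length-++; length-filter; filter-++; filter-none; length-tabulate)
open import Data.List.Relation.Unary.All using (All; []; _∷_)
open import Data.List.Relation.Unary.All.Properties using (all-filter; tabulate⁺)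
open import Data.List.Relation.Unary.Unique.Propositional using (Unique; []; _∷_)
open import Data.List.Relation.Unary.Unique.Propositional.Properties using (allFin⁺; filter⁺)
open import Data.Product using (Σ; ∃; _×_; _,_; proj₁; proj₂)
open import Data.Sum using (_⊎_; inj₁; inj₂)
open import Data.Empty using (⊥-elim)
open import Function using (_∘_; id)
open import Function.Bundles using (Equivalence)
open import Function.Definitions using (Injective)
open import Level using (0ℓ)
open import Relation.Nullary using (¬_; Dec; yes; no)
open import Relation.Nullary.Decidable using (T?; ¬?; _×-dec_)
open import Relation.Unary using (Pred; Decidable)
open import Relation.Binary.PropositionalEquality
  using (_≡_; _≢_; refl; sym; trans; cong; subst; module ≡-Reasoning)

-- An injective endomap of a finite set is surjective (otherwise it would
-- inject Fin (suc m) into Fin m by punching out a missed value).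
injective⇒surjective : ∀ {m} (f : Fin m → Fin m) → Injective _≡_ _≡_ f →
                       ∀ y → ∃ λ x → f x ≡ y
injective⇒surjective {zero}  f f-inj ()
injective⇒surjective {suc m} f f-inj y with any? (λ x → f x ≟ y)
... | yes hit = hit
... | no miss = ⊥-elim (1+n≰n (injective⇒≤ {f = g} g-inj))
  where
  missed : ∀ x → y ≢ f x
  missed x y≡fx = miss (x , sym y≡fx)
  g : Fin (suc m) → Fin m
  g x = punchOut (missed x)
  g-inj : Injective _≡_ _≡_ g
  g-inj {x} {x'} gx≡gx' = f-inj (punchOut-injective (missed x) (missed x') gx≡gx')

-- Conversely a surjective endomap of a finite set is injective: a section g
-- of f is injective, hence surjective, so g is a two-sided inverse of f.
surjective⇒injective : ∀ {m} (f : Fin m → Fin m) → (∀ y → ∃ λ x → f x ≡ y) →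
                       Injective _≡_ _≡_ f
surjective⇒injective f surj {i} {j} fi≡fj = begin
  i       ≡⟨ retract i ⟩
  g (f i) ≡⟨ cong g fi≡fj ⟩
  g (f j) ≡⟨ sym (retract j) ⟩
  j       ∎
  where
  open ≡-Reasoning
  g : _ → _
  g y = proj₁ (surj y)
  section : ∀ y → f (g y) ≡ y
  section y = proj₂ (surj y)
  g-inj : Injective _≡_ _≡_ g
  g-inj {y} {y'} gy≡gy' = trans (sym (section y)) (trans (cong f gy≡gy') (section y'))
  retract : ∀ x → x ≡ g (f x)
  retract x with injective⇒surjective g g-inj x
  ... | y , gy≡x = begin
    x           ≡⟨ sym gy≡x ⟩
    g y         ≡⟨ cong g (sym (section y)) ⟩
    g (f (g y)) ≡⟨ cong (g ∘ f) gy≡x ⟩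
    g (f x)     ∎

tabulate-++ : ∀ {A : Set} m {n} (f : Fin (m + n) → A) →
              tabulate f ≡ tabulate (f ∘ (_↑ˡ n)) ++ tabulate (f ∘ (m ↑ʳ_))
tabulate-++ zero    f = refl
tabulate-++ (suc m) f = cong (f Fin.zero ∷_) (tabulate-++ m (f ∘ Fin.suc))

count-half≤ : ∀ a {P : Pred (Fin (a + a)) 0ℓ} (P? : Decidable P) →
              (∀ i → ¬ P (i ↑ˡ a)) ⊎ (∀ i → ¬ P (a ↑ʳ i)) →
              length (filter P? (allFin (a + a))) ≤ a
count-half≤ a {P} P? empty-half = begin
  length (filter P? (allFin (a + a)))     ≡⟨ cong (length ∘ filter P?) (tabulate-++ a id) ⟩
  length (filter P? (low ++ high))        ≡⟨ cong length (filter-++ P? low high) ⟩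
  length (filter P? low ++ filter P? high) ≡⟨ length-++ (filter P? low) ⟩
  length (filter P? low) + length (filter P? high) ≤⟨ halves empty-half ⟩
  a                                        ∎
  where
  open ≤-Reasoning
  low high : List (Fin (a + a))
  low  = tabulate (_↑ˡ a)
  high = tabulate (a ↑ʳ_)
  count≤a : ∀ {f : Fin a → Fin (a + a)} → length (filter P? (tabulate f)) ≤ a
  count≤a {f} = ≤-trans (length-filter P? (tabulate f)) (≤-reflexive (length-tabulate f))
  halves : (∀ i → ¬ P (i ↑ˡ a)) ⊎ (∀ i → ¬ P (a ↑ʳ i)) →
           length (filter P? low) + length (filter P? high) ≤ a
  halves (inj₁ none) rewrite filter-none P? (tabulate⁺ {f = _↑ˡ a} none) = count≤a
  halves (inj₂ none) rewrite filter-none P? (tabulate⁺ {f = a ↑ʳ_} none) | +-identityʳ (length (filter P? low)) = count≤a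

unique-subsingleton-length : ∀ {A : Set} {P : Pred A 0ℓ} {xs : List A} → Unique xs → All P xs →
                             (∀ {x y} → P x → P y → x ≡ y) → length xs ≤ 1
unique-subsingleton-length [] [] same = z≤n
unique-subsingleton-length (_ ∷ _) (_ ∷ []) same = s≤s z≤n
unique-subsingleton-length ((x≢y ∷ _) ∷ _) (px ∷ py ∷ _) same = ⊥-elim (x≢y (same px py))

count-subsingleton≤1 : ∀ {n} {P : Pred (Fin n) 0ℓ} (P? : Decidable P) →
                       (∀ {x y} → P x → P y → x ≡ y) → length (filter P? (allFin n)) ≤ 1
count-subsingleton≤1 {n} P? same =
  unique-subsingleton-length (filter⁺ P? (allFin⁺ n)) (all-filter P? (allFin n)) same

HasPartner : ∀ {n} → Digraph n → Fin n → Set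
HasPartner {n} D u = Σ (Fin n) (λ v → u ≢ v × Σ (Fin n) (λ z → Arc D u z × Arc D v z))

hasPartner? : ∀ {n} (D : Digraph n) (u : Fin n) → Dec (HasPartner D u)
hasPartner? D u = any? (λ v → ¬? (u ≟ v) ×-dec any? (λ z → T? (adj D u z) ×-dec T? (adj D v z)))

InUnique : ∀ {n} → Digraph n → Set
InUnique D = ∀ {w w' x} → Arc D w x → Arc D w' x → w ≡ w'

partnerless-sole : ∀ {n} (D : Digraph n) {w y z} → ¬ HasPartner D w →
                   Arc D w z → Arc D y z → w ≡ y
partnerless-sole D {w} {y} no-partner wz yz with w ≟ y
... | yes w≡y = w≡y
... | no  w≢y = ⊥-elim (no-partner (y , w≢y , _ , wz , yz))

-- The degree counts filter on adj D x y ≡ true; this recovers the arc.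
arc-from-≡ : ∀ {n} (D : Digraph n) {x y} → adj D x y ≡ true → Arc D x y
arc-from-≡ D = Equivalence.from T-≡

-- d⁺(z) ≤ a in a balanced bipartite digraph: the out-neighbours of z lie
-- in the part not containing z, which has a vertices.
outdeg≤ : ∀ a (D : Digraph (a + a)) → IsBipartite a D → ∀ z → outdeg D z ≤ a
outdeg≤ a D bipartite z with toℕ z <? a
... | yes z∈X = count-half≤ a _ (inj₁ λ i e →
      bipartite z (i ↑ˡ a) (arc-from-≡ D e) (inj₁ (z∈X , subst (_< a) (sym (toℕ-↑ˡ i a)) (toℕ<n i))))
... | no  z∉X = count-half≤ a _ (inj₂ λ i e →
      bipartite z (a ↑ʳ i) (arc-from-≡ D e) (inj₂ (z∉X , λ i∈X → m+n≮m a (toℕ i) (subst (_< a) (toℕ-↑ʳ a i) i∈X))))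

indeg≤1 : ∀ {n} (D : Digraph n) z → (∀ {x y} → Arc D x z → Arc D y z → x ≡ y) → indeg D z ≤ 1
indeg≤1 D z same = count-subsingleton≤1 _ (λ xz yz → same (arc-from-≡ D xz) (arc-from-≡ D yz))

-- The two alternatives B_k offers for a vertex with a partner both need
-- degree larger than a + 1 when 2 ≤ k and 2k ≤ a.
large-degree-impossible : ∀ {a k d} → 2 ≤ k → 2 * k ≤ a → d ≤ a + 1 →
                          ¬ (a + k ≤ d ⊎ a + a ≤ d + k)
large-degree-impossible {a} {k} {d} 2≤k 2k≤a d≤a+1 (inj₁ a+k≤d) =
  ≤⇒≯ (+-cancelˡ-≤ a k 1 (≤-trans a+k≤d d≤a+1)) 2≤k
large-degree-impossible {a} {k} {d} 2≤k 2k≤a d≤a+1 (inj₂ 2a≤d+k) = ≤⇒≯ k≤1 2≤k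
  where
  open ≤-Reasoning
  a≤1+k : a ≤ 1 + k
  a≤1+k = +-cancelˡ-≤ a a (1 + k) (begin
    a + a       ≤⟨ 2a≤d+k ⟩
    d + k       ≤⟨ +-monoˡ-≤ k d≤a+1 ⟩
    a + 1 + k   ≡⟨ +-assoc a 1 k ⟩
    a + (1 + k) ∎)
  k≤1 : k ≤ 1
  k≤1 = +-cancelʳ-≤ k k 1 (begin
    k + k       ≡⟨ cong (k +_) (sym (+-identityʳ k)) ⟩
    2 * k       ≤⟨ 2k≤a ⟩
    a           ≤⟨ a≤1+k ⟩
    1 + k       ∎)

module Propagation (a k : ℕ) (2≤k : 2 ≤ k) (2k≤a : 2 * k ≤ a) (D : Digraph (a + a))
                   (bipartite : IsBipartite a D) (condB : ConditionB a k D) where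

  deg-after-partnerless : ∀ {w z} → ¬ HasPartner D w → Arc D w z → deg D z ≤ a + 1
  deg-after-partnerless {w} {z} no-partner wz = +-mono-≤ (outdeg≤ a D bipartite z) (indeg≤1 D z same)
    where
    same : ∀ {x y} → Arc D x z → Arc D y z → x ≡ y
    same xz yz = trans (sym (partnerless-sole D no-partner wz xz)) (partnerless-sole D no-partner wz yz)

  partner⇒large-degree : ∀ {z} → HasPartner D z → a + k ≤ deg D z ⊎ a + a ≤ deg D z + k
  partner⇒large-degree {z} (v , z≢v , common) with condB z v (z≢v , common)
  ... | inj₁ (big , _) = inj₂ big
  ... | inj₂ (big , _) = inj₁ big

  partnerless-step : ∀ {w z} → ¬ HasPartner D w → Arc D w z → ¬ HasPartner D z
  partnerless-step no-partner wz partner =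
    large-degree-impossible 2≤k 2k≤a (deg-after-partnerless no-partner wz) (partner⇒large-degree partner)

  partnerless-reach : ∀ {w z} → Reach D w z → ¬ HasPartner D w → ¬ HasPartner D z
  partnerless-reach here        no-partner = no-partner
  partnerless-reach (step wy r) no-partner = partnerless-reach r (partnerless-step no-partner wy)

first-arc : ∀ {n} {D : Digraph n} {w v} → Reach D w v → w ≢ v → Σ (Fin n) (Arc D w)
first-arc here        w≢w = ⊥-elim (w≢w refl)
first-arc (step wy _) _   = _ , wy

out-neighbour : ∀ {n} (D : Digraph n) → StronglyConnected D → 2 ≤ n → (w : Fin n) → Σ (Fin n) (Arc D w)
out-neighbour D strong (s≤s (s≤s _)) Fin.zero    = first-arc (strong Fin.zero (Fin.suc Fin.zero)) (λ ())
out-neighbour D strong (s≤s (s≤s _)) (Fin.suc i) = first-arc (strong (Fin.suc i) Fin.zero) (λ ())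

module SuccessorCycle {m} (D : Digraph (suc m)) (strong : StronglyConnected D) (inUnique : InUnique D)
                      (q : Fin (suc m) → Fin (suc m)) (q-arc : ∀ w → Arc D w (q w)) where

  N : ℕ
  N = suc m

  q-injective : Injective _≡_ _≡_ q
  q-injective {w} {w'} qw≡qw' = inUnique (q-arc w) (subst (Arc D w') (sym qw≡qw') (q-arc w'))

  -- Every arc wx is the arc w q(w): x = q(y) for some y, and y = w by in-uniqueness.
  arc⇒q : ∀ {w x} → Arc D w x → x ≡ q w
  arc⇒q {w} {x} wx with injective⇒surjective q q-injective x
  ... | y , qy≡x = trans (sym qy≡x) (cong q (inUnique (subst (Arc D y) qy≡x (q-arc y)) wx))

  iter : ℕ → Fin N → Fin N
  iter zero    x = x
  iter (suc k) x = q (iter k x)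

  iter-q : ∀ k x → iter k (q x) ≡ q (iter k x)
  iter-q zero    x = refl
  iter-q (suc k) x = cong q (iter-q k x)

  iter-+ : ∀ i j x → iter (i + j) x ≡ iter i (iter j x)
  iter-+ zero    j x = refl
  iter-+ (suc i) j x = cong q (iter-+ i j x)

  iter-injective : ∀ k {x y} → iter k x ≡ iter k y → x ≡ y
  iter-injective zero    e = e
  iter-injective (suc k) e = iter-injective k (q-injective e)

  reach⇒iter : ∀ {w v} → Reach D w v → ∃ λ k → v ≡ iter k w
  reach⇒iter here = 0 , refl
  reach⇒iter {w} (step wy r) with reach⇒iter r
  ... | k , v≡ = suc k , trans v≡ (trans (cong (iter k) (arc⇒q wy)) (iter-q k w))

  u : Fin N
  u = Fin.zero

  -- By pigeonhole on u, q(u), …, q^N(u), some 0 < d ≤ N has q^d(u) = u.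
  period : Σ ℕ λ d → 0 < d × d ≤ N × iter d u ≡ u
  period with pigeonhole (n<1+n N) (λ i → iter (toℕ i) u)
  ... | i , j , i<j , eq = toℕ j ∸ toℕ i , m<n⇒0<n∸m i<j
                         , ≤-trans (m∸n≤m (toℕ j) (toℕ i)) (≤-pred (toℕ<n j))
                         , iter-injective (toℕ i) (begin
    iter (toℕ i) (iter (toℕ j ∸ toℕ i) u) ≡⟨ sym (iter-+ (toℕ i) _ u) ⟩
    iter (toℕ i + (toℕ j ∸ toℕ i)) u      ≡⟨ cong (λ t → iter t u) (m+[n∸m]≡n (<⇒≤ i<j)) ⟩
    iter (toℕ j) u                        ≡⟨ sym eq ⟩
    iter (toℕ i) u                        ∎)
    where open ≡-Reasoning

  d : ℕ
  d = proj₁ period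

  0<d : 0 < d
  0<d = proj₁ (proj₂ period)

  d≤N : d ≤ N
  d≤N = proj₁ (proj₂ (proj₂ period))

  iter-d : iter d u ≡ u
  iter-d = proj₂ (proj₂ (proj₂ period))

  orbit-reduce : ∀ k → Σ ℕ λ r → r < d × iter k u ≡ iter r u
  orbit-reduce zero = 0 , 0<d , refl
  orbit-reduce (suc k) with orbit-reduce k
  ... | r , r<d , e with suc r <? d
  ...   | yes 1+r<d = suc r , 1+r<d , cong q e
  ...   | no  1+r≮d = 0 , 0<d , trans (cong q e)
          (trans (cong (λ t → iter t u) (≤-antisym r<d (≮⇒≥ 1+r≮d))) iter-d)

  -- The candidate cycle σ(i) = q^i(u); it covers all vertices by strong connectivity.
  σ : Fin N → Fin N
  σ i = iter (toℕ i) u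

  σ-surjective : ∀ v → ∃ λ i → σ i ≡ v
  σ-surjective v with reach⇒iter (strong u v)
  ... | k , v≡ with orbit-reduce k
  ...   | r , r<d , e = fromℕ< r<N , trans (cong (λ t → iter t u) (toℕ-fromℕ< r<N)) (sym (trans v≡ e))
    where r<N = ≤-trans r<d d≤N

  σ-injective : Injective _≡_ _≡_ σ
  σ-injective = surjective⇒injective σ σ-surjective

  -- The period is exactly N, since q^d(u) = u = σ(0) and σ is injective.
  d≡N : d ≡ N
  d≡N with d <? N
  ... | no  d≮N = ≤-antisym d≤N (≮⇒≥ d≮N)
  ... | yes d<N = ⊥-elim (<⇒≢ 0<d (sym (trans (sym (toℕ-fromℕ< d<N)) (cong toℕ d↦0))))
    where
    d↦0 : fromℕ< d<N ≡ Fin.zero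
    d↦0 = σ-injective (trans (cong (λ t → iter t u) (toℕ-fromℕ< d<N)) iter-d)

  iter-N : iter N u ≡ u
  iter-N = subst (λ t → iter t u ≡ u) d≡N iter-d

  -- Consecutive entries are joined by the arcs w q(w), the last one closing up since q^N(u) = u.
  σ-next : ∀ i → Arc D (σ i) (σ (next i))
  σ-next i with suc (toℕ i) <? N
  ... | yes 1+i<N = subst (Arc D (σ i)) (sym (cong (λ t → iter t u) (toℕ-fromℕ< 1+i<N))) (q-arc (σ i))
  ... | no  1+i≮N = subst (λ t → Arc D t u) (sym (cong (λ t → iter t u) i≡m))
                      (subst (Arc D (iter m u)) iter-N (q-arc (iter m u)))
    where
    i≡m : toℕ i ≡ m
    i≡m = ≤-antisym (≤-pred (toℕ<n i)) (≤-pred (≮⇒≥ 1+i≮N))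

  hamiltonian : Hamiltonian D
  hamiltonian = record { to = σ ; cong = cong σ
                       ; bijective = σ-injective , λ v → proj₁ (σ-surjective v) , λ { refl → proj₂ (σ-surjective v) } }
              , σ-next

in-unique⇒hamiltonian : ∀ {n} (D : Digraph n) → 2 ≤ n → StronglyConnected D → InUnique D → Hamiltonian D
in-unique⇒hamiltonian D 2≤n@(s≤s _) strong inUnique =
  SuccessorCycle.hamiltonian D strong inUnique (proj₁ ∘ succ) (proj₂ ∘ succ)
  where succ = out-neighbour D strong 2≤n

-- If u had no partner, no vertex would (propagation along walks from u), so
-- every in-degree is at most one and D would be Hamiltonian.
lemma4p1 : (a k : ℕ) → 4 ≤ a → 2 ≤ k → 2 * k ≤ a →
    (D : Digraph (a + a)) → IsBipartite a D → StronglyConnected D →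
    ConditionB a k D → ¬ Hamiltonian D →
    (u : Fin (a + a)) → Σ (Fin (a + a)) (λ v → u ≢ v × Σ (Fin (a + a)) (λ z → Arc D u z × Arc D v z))
lemma4p1 a k 4≤a 2≤k 2k≤a D bipartite strong condB non-hamiltonian u with hasPartner? D u
... | yes partner    = partner
... | no  no-partner = ⊥-elim (non-hamiltonian (in-unique⇒hamiltonian D 2≤2a strong inUnique))
  where
  open Propagation a k 2≤k 2k≤a D bipartite condB
  partnerless : ∀ v → ¬ HasPartner D v
  partnerless v = partnerless-reach (strong u v) no-partner
  inUnique : InUnique D
  inUnique {w} wx w'x = partnerless-sole D (partnerless w) wx w'x
  2≤2a : 2 ≤ a + a
  2≤2a = ≤-trans (≤-trans (s≤s (s≤s z≤n)) 4≤a) (m≤m+n a a)
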